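{- Let $G$ be a finite abelian group (written additively), let $s$ be a positive integer, and let $A \subseteq G$ be a perfect $s$-basis of $G$. Then either $s=1$ and $A=G\setminus\{0\}$, or $G\cong \mathbb{Z}_{s+1}$ and $|A|=1$.
   Context: For a subset $A$ of $G$ and an integer $h\ge 0$, $hA$ denotes the set of all sums of exactly $h$ not-necessarily-distinct elements of $A$ (with $0A=\{0\}$). A subset $A\subseteq G$ is a perfect $s$-basis of $G$ if every element of $G$ can be written as a sum of at most $s$ (not-necessarily-distinct) elements of $A$, i.e. $\bigcup_{h=0}^{s} hA = G$, and this representation is unique apart from the order of the terms (the empty sum representing $0$ counts as a representation). $\mathbb{Z}_n=\mathbb{Z}/n\mathbb{Z}$. -}

module Defs where

open import Level using (0ℓ)
open import Algebra.Bundles using (AbelianGroup)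
open import Data.Nat using (ℕ; zero; suc; _+_; _≤_)
open import Data.Nat.DivMod using (_mod_)
open import Data.Fin using (Fin; toℕ)
open import Data.List using (List; []; _∷_; length)
open import Data.List.Relation.Unary.Any using (Any)
open import Data.List.Relation.Unary.AllPairs using (AllPairs)
open import Data.Vec using (Vec; []; _∷_)
open import Data.Product using (Σ; ∃; _×_; _,_)
open import Data.Sum using (_⊎_)
open import Relation.Binary.PropositionalEquality using (_≡_)
open import Relation.Nullary using (¬_)
import Algebra.Definitions.RawMonoid as RM

_+ℤ[_]_ : {k : ℕ} → Fin (suc k) → (k' : ℕ) → Fin (suc k) → Fin (suc k)
_+ℤ[_]_ {k} a _ b = (toℕ a + toℕ b) mod (suc k)

module _ (G : AbelianGroup 0ℓ 0ℓ) where
  open AbelianGroup G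
  open RM rawMonoid using () renaming (_×_ to _·_)

  _∈ₛ_ : Carrier → List Carrier → Set
  x ∈ₛ xs = Any (x ≈_) xs

  IsFinite : Set
  IsFinite = Σ (List Carrier) λ xs → ∀ x → x ∈ₛ xs

  -- A subset A ⊆ G, given as a list of pairwise distinct elements
  Distinct : List Carrier → Set
  Distinct = AllPairs (λ x y → ¬ (x ≈ y))

  -- total size of a multiset given by a multiplicity vector
  total : {k : ℕ} → Vec ℕ k → ℕ
  total [] = 0
  total (m ∷ ms) = m + total ms

  msum : (A : List Carrier) → Vec ℕ (length A) → Carrier
  msum [] [] = ε
  msum (a ∷ as) (m ∷ ms) = (m · a) ∙ msum as ms

  -- A is a perfect s-basis: every g is a sum of at most s elements of A,
  -- uniquely as a multiset (i.e. apart from the order of the terms).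
  PerfectBasis : ℕ → List Carrier → Set
  PerfectBasis s A =
    (g : Carrier) →
      Σ (Vec ℕ (length A)) λ m →
        (total m ≤ s × msum A m ≈ g) ×
        ((m' : Vec ℕ (length A)) → total m' ≤ s → msum A m' ≈ g → m' ≡ m)

  IsoToZ : ℕ → Set
  IsoToZ s = Σ (Fin (suc s) → Carrier) λ φ →
      (∀ a b → φ (a +ℤ[ s ] b) ≈ (φ a ∙ φ b))
    × (∀ a b → φ a ≈ φ b → a ≡ b)
    × (∀ x → ∃ λ a → φ a ≈ x)

module Submission where

-- Every g ∈ G is the sum of a unique multiset rep g of size ≤ s over A.  For s = 1 this says
-- exactly that A = G ∖ {0}.  For s ≥ 2 and A = {a}, the representation of (s+1)a forces
-- (s+1)a = 0, and i ↦ i·a is an isomorphism from ℤ_(s+1).  For s ≥ 2 and two elements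
-- a₀, a₁ ∈ A, split one copy of the first element off rep g and send g to the difference of the
-- two parts, arranged as in simpleFirst/dropFirst.  Both parts have size ≤ 1 and ≤ s - 1, so
-- uniqueness of representations of size ≤ s makes this self-map of G injective, and
-- a₁ - a₀ is not in its image (using 2 ≤ s), which is impossible in a finite group.

open import Defs
open import Level using (0ℓ)
open import Algebra.Bundles using (AbelianGroup)
open import Data.Nat using (ℕ; zero; suc; _+_; _*_; _∸_; _≤_; z≤n; s≤s)
open import Data.Nat.Properties
  using ( ≤-refl; ≤-reflexive; ≤-trans; ≤-pred; n≤1+n; 1+n≰n; 1+n≢0; n≤0⇒n≡0; +-identityˡ
        ; +-identityʳ; +-mono-≤; ∸-monoˡ-≤; m+[n∸m]≡n; +-commutativeSemigroup; module ≤-Reasoning)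
open import Data.Nat.DivMod using (_mod_; _%_; _/_; m≡m%n+[m/n]*n; m%n<n)
open import Data.Fin using (Fin; toℕ; fromℕ<)
open import Data.Fin.Properties using (toℕ-fromℕ<; toℕ-injective; toℕ<n)
open import Data.Vec using (Vec; []; _∷_; replicate; zipWith; sum; head)
open import Data.Vec.Properties using (∷-injective; zipWith-identityˡ; ≡-dec)
open import Data.List using (List; []; _∷_; map; length; deduplicate)
open import Data.List.Properties using (length-map; length-removeAt′)
open import Data.List.Relation.Unary.Any using (here; there; index)
open import Data.List.Relation.Unary.AllPairs using ([]; _∷_)
import Data.List.Relation.Unary.All as All
open import Data.List.Relation.Unary.All.Properties using () renaming (map⁺ to All-map⁺)
open import Data.Product using (∃; _×_; _,_; proj₁; proj₂)
open import Data.Sum using (_⊎_; inj₁; inj₂)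
open import Data.Empty using (⊥-elim)
open import Relation.Nullary using (¬_)
open import Relation.Nullary.Decidable using (map′)
open import Relation.Binary.Bundles using (Setoid; DecSetoid)
open import Relation.Binary.Definitions using (Decidable; _Respects_)
open import Relation.Binary.PropositionalEquality as ≡ using (_≡_; cong)
import Data.List.Membership.Setoid as SetoidMembership
import Data.List.Membership.Setoid.Properties as SetoidMembershipProperties
import Data.List.Relation.Unary.Unique.Setoid as SetoidUnique
import Data.List.Relation.Unary.Unique.Setoid.Properties as SetoidUniqueProperties
open import Data.List.Relation.Unary.Unique.DecSetoid.Properties using (deduplicate-!)
import Data.List.Relation.Binary.Subset.Setoid as SetoidSubset
import Algebra.Definitions.RawMonoid as RawMonoidDefinitions
import Algebra.Properties.Monoid as MonoidProperties
import Algebra.Properties.Monoid.Mult as MonoidMult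
import Algebra.Properties.CommutativeSemigroup as CommutativeSemigroupProperties
import Algebra.Properties.Group as GroupProperties

module Pigeonhole {c ℓ} (S : Setoid c ℓ) where
  open Setoid S
  open SetoidMembership S using (_∈_; _─_)
  open SetoidUnique S using (Unique)
  open SetoidSubset S using (_⊆_)

  ∈-─⁺ : ∀ {x y ys} (x∈ys : x ∈ ys) → y ∈ ys → ¬ x ≈ y → y ∈ ys ─ x∈ys
  ∈-─⁺ (here x≈z) (here y≈z) x≉y = ⊥-elim (x≉y (trans x≈z (sym y≈z)))
  ∈-─⁺ (here _) (there y∈ys) _ = y∈ys
  ∈-─⁺ (there _) (here y≈z) _ = here y≈z
  ∈-─⁺ (there x∈ys) (there y∈ys) x≉y = there (∈-─⁺ x∈ys y∈ys x≉y)

  Unique-⊆⇒length-≤ : ∀ {xs ys} → Unique xs → xs ⊆ ys → length xs ≤ length ys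
  Unique-⊆⇒length-≤ [] _ = z≤n
  Unique-⊆⇒length-≤ {x ∷ xs} {ys} (x≉xs ∷ xs!) xs⊆ys = begin
    suc (length xs)          ≤⟨ s≤s (Unique-⊆⇒length-≤ xs! xs⊆ys─x) ⟩
    suc (length (ys ─ x∈ys)) ≡⟨ length-removeAt′ ys (index x∈ys) ⟨
    length ys                ∎
    where
    open ≤-Reasoning
    x∈ys : x ∈ ys
    x∈ys = xs⊆ys (here refl)
    x≉-resp : (λ z → ¬ x ≈ z) Respects _≈_
    x≉-resp y≈z x≉y x≈z = x≉y (trans x≈z (sym y≈z))
    xs⊆ys─x : xs ⊆ ys ─ x∈ys
    xs⊆ys─x y∈xs = ∈-─⁺ x∈ys (xs⊆ys (there y∈xs)) (All.lookupₛ S x≉-resp x≉xs y∈xs)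

module _ {c ℓ} (S : DecSetoid c ℓ) where
  open DecSetoid S
  open SetoidMembership setoid using (_∈_)

  injective⇒¬¬surjective : (xs : List Carrier) → (∀ x → x ∈ xs) →
                           (f : Carrier → Carrier) → (∀ {x y} → f x ≈ f y → x ≈ y) →
                           ∀ y → ¬ (∀ x → ¬ f x ≈ y)
  injective⇒¬¬surjective xs complete f f-inj y y∉image = 1+n≰n (begin
    suc (length L)          ≡⟨ cong suc (length-map f L) ⟨
    length (y ∷ map f L)    ≤⟨ Pigeonhole.Unique-⊆⇒length-≤ setoid y∷fL! (λ {z} _ → ∈L z) ⟩
    length L                ∎)
    where
    open ≤-Reasoning
    L : List Carrier
    L = deduplicate _≟_ xs
    ∈L : ∀ z → z ∈ L
    ∈L z = SetoidMembershipProperties.∈-deduplicate⁺ setoid _≟_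
             (λ z≈y x≈y → trans x≈y (sym z≈y)) (complete z)
    y∷fL! : SetoidUnique.Unique setoid (y ∷ map f L)
    y∷fL! = All-map⁺ (All.universal (λ x y≈fx → y∉image x (sym y≈fx)) L)
          ∷ SetoidUniqueProperties.map⁺ setoid setoid f-inj (deduplicate-! S xs)

infixl 6 _⊕_
_⊕_ : ∀ {n} → Vec ℕ n → Vec ℕ n → Vec ℕ n
_⊕_ = zipWith _+_

sum-⊕ : ∀ {n} (u v : Vec ℕ n) → sum (u ⊕ v) ≡ sum u + sum v
sum-⊕ [] [] = ≡.refl
sum-⊕ (x ∷ u) (y ∷ v) = ≡.trans (cong (x + y +_) (sum-⊕ u v)) (interchange x y (sum u) (sum v))
  where open CommutativeSemigroupProperties +-commutativeSemigroup using (interchange)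

sum-replicate-0 : ∀ n → sum (replicate n 0) ≡ 0
sum-replicate-0 zero = ≡.refl
sum-replicate-0 (suc n) = sum-replicate-0 n

sum≡0⇒replicate-0 : ∀ {n} (m : Vec ℕ n) → sum m ≡ 0 → m ≡ replicate n 0
sum≡0⇒replicate-0 [] _ = ≡.refl
sum≡0⇒replicate-0 (zero ∷ m) sum≡0 = cong (0 ∷_) (sum≡0⇒replicate-0 m sum≡0)

-- If uᵢ is the first nonzero entry of u, then dropFirst u = u - eᵢ, while simpleFirst u is eᵢ
-- when uᵢ = 1 and 0 otherwise.  Taking eᵢ itself in place of simpleFirst u would break
-- simpleFirst-dropFirst-injective: u = 0 and v = 2e₀ would have equal cross sums.
dropFirst : ∀ {n} → Vec ℕ n → Vec ℕ n
dropFirst [] = []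
dropFirst (zero ∷ u) = 0 ∷ dropFirst u
dropFirst (suc j ∷ u) = j ∷ u

simpleFirst : ∀ {n} → Vec ℕ n → Vec ℕ n
simpleFirst [] = []
simpleFirst (zero ∷ u) = 0 ∷ simpleFirst u
simpleFirst {suc n} (suc zero ∷ u) = 1 ∷ replicate n 0
simpleFirst {suc n} (suc (suc _) ∷ u) = replicate (suc n) 0

sum-dropFirst : ∀ {n} (u : Vec ℕ n) → sum (dropFirst u) ≡ sum u ∸ 1
sum-dropFirst [] = ≡.refl
sum-dropFirst (zero ∷ u) = sum-dropFirst u
sum-dropFirst (suc j ∷ u) = ≡.refl

sum-simpleFirst-≤1 : ∀ {n} (u : Vec ℕ n) → sum (simpleFirst u) ≤ 1
sum-simpleFirst-≤1 [] = z≤n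
sum-simpleFirst-≤1 (zero ∷ u) = sum-simpleFirst-≤1 u
sum-simpleFirst-≤1 {suc n} (suc zero ∷ u) = ≤-reflexive (cong suc (sum-replicate-0 n))
sum-simpleFirst-≤1 {suc n} (suc (suc _) ∷ u) = ≤-trans (≤-reflexive (sum-replicate-0 n)) z≤n

replicate-0-⊕-injective : ∀ {n} {u v : Vec ℕ n} → replicate n 0 ⊕ u ≡ replicate n 0 ⊕ v → u ≡ v
replicate-0-⊕-injective {u = u} {v} eq = begin
  u                  ≡⟨ zipWith-identityˡ +-identityˡ u ⟨
  replicate _ 0 ⊕ u  ≡⟨ eq ⟩
  replicate _ 0 ⊕ v  ≡⟨ zipWith-identityˡ +-identityˡ v ⟩
  v                  ∎
  where open ≡.≡-Reasoning

simpleFirst-dropFirst-injective : ∀ {n} (u v : Vec ℕ n) →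
  simpleFirst u ⊕ dropFirst v ≡ simpleFirst v ⊕ dropFirst u → u ≡ v
simpleFirst-dropFirst-injective [] [] _ = ≡.refl
simpleFirst-dropFirst-injective (zero ∷ u) (zero ∷ v) eq =
  cong (0 ∷_) (simpleFirst-dropFirst-injective u v (proj₂ (∷-injective eq)))
simpleFirst-dropFirst-injective (suc zero ∷ u) (suc zero ∷ v) eq =
  cong (1 ∷_) (≡.sym (replicate-0-⊕-injective (proj₂ (∷-injective eq))))
simpleFirst-dropFirst-injective (suc (suc j) ∷ u) (suc (suc k) ∷ v) eq
  with k≡j , tails ← ∷-injective eq =
  ≡.cong₂ _∷_ (cong suc (≡.sym k≡j)) (≡.sym (replicate-0-⊕-injective tails))
simpleFirst-dropFirst-injective (zero ∷ u) (suc zero ∷ v) ()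
simpleFirst-dropFirst-injective (zero ∷ u) (suc (suc k) ∷ v) ()
simpleFirst-dropFirst-injective (suc zero ∷ u) (zero ∷ v) ()
simpleFirst-dropFirst-injective (suc (suc j) ∷ u) (zero ∷ v) ()
simpleFirst-dropFirst-injective (suc zero ∷ u) (suc (suc k) ∷ v) ()
simpleFirst-dropFirst-injective (suc (suc j) ∷ u) (suc zero ∷ v) ()

e₀ e₁ : ∀ n → Vec ℕ (suc (suc n))
e₀ n = 1 ∷ 0 ∷ replicate n 0
e₁ n = 0 ∷ 1 ∷ replicate n 0

sum-e₀ sum-e₁ : ∀ n → sum (e₀ n) ≡ 1
sum-e₀ n = cong suc (sum-replicate-0 n)
sum-e₁ n = cong suc (sum-replicate-0 n)

simpleFirst⊕e₀≢e₁⊕dropFirst : ∀ {n} (u : Vec ℕ (suc (suc n))) →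
  ¬ simpleFirst u ⊕ e₀ n ≡ e₁ n ⊕ dropFirst u
simpleFirst⊕e₀≢e₁⊕dropFirst (zero ∷ _ ∷ _) ()
simpleFirst⊕e₀≢e₁⊕dropFirst (suc zero ∷ _ ∷ _) ()
simpleFirst⊕e₀≢e₁⊕dropFirst (suc (suc _) ∷ _ ∷ _) eq with () ← proj₂ (∷-injective eq)

sum-⊕-≤ : ∀ {n i j} (u v : Vec ℕ n) → sum u ≤ i → sum v ≤ j → sum (u ⊕ v) ≤ i + j
sum-⊕-≤ u v u≤i v≤j = ≤-trans (≤-reflexive (sum-⊕ u v)) (+-mono-≤ u≤i v≤j)

sum-⊕-dropFirst-≤ : ∀ {n s} (w v : Vec ℕ n) → 1 ≤ s → sum w ≤ 1 → sum v ≤ s → sum (w ⊕ dropFirst v) ≤ s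
sum-⊕-dropFirst-≤ {s = s} w v 1≤s w≤1 v≤s = begin
  sum (w ⊕ dropFirst v)   ≤⟨ sum-⊕-≤ w (dropFirst v) w≤1 (≤-trans (≤-reflexive (sum-dropFirst v)) (∸-monoˡ-≤ 1 v≤s)) ⟩
  1 + (s ∸ 1)             ≡⟨ m+[n∸m]≡n 1≤s ⟩
  s                       ∎
  where open ≤-Reasoning

module _ (G : AbelianGroup 0ℓ 0ℓ) where
  open AbelianGroup G
  open RawMonoidDefinitions rawMonoid using () renaming (_×_ to _·_)
  open MonoidMult monoid using (×-homo-+; ×-congʳ; ×-assocˡ)
  open MonoidProperties monoid using (insertᶜ; cancelᶜ)
  open GroupProperties group using (∙-cancelˡ)
  open CommutativeSemigroupProperties commutativeSemigroup using (interchange)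
  open SetoidMembership setoid using (_∈_)
  open import Relation.Binary.Reasoning.Setoid setoid

  total≡sum : ∀ {n} (m : Vec ℕ n) → total G m ≡ sum m
  total≡sum [] = ≡.refl
  total≡sum (j ∷ m) = cong (j +_) (total≡sum m)

  msum-⊕ : ∀ A (u v : Vec ℕ (length A)) → msum G A (u ⊕ v) ≈ msum G A u ∙ msum G A v
  msum-⊕ [] [] [] = sym (identityˡ ε)
  msum-⊕ (a ∷ A) (i ∷ u) (j ∷ v) = begin
    (i + j) · a ∙ msum G A (u ⊕ v)              ≈⟨ ∙-cong (×-homo-+ a i j) (msum-⊕ A u v) ⟩
    (i · a ∙ j · a) ∙ (msum G A u ∙ msum G A v) ≈⟨ interchange _ _ _ _ ⟩
    (i · a ∙ msum G A u) ∙ (j · a ∙ msum G A v) ∎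

  msum-replicate-0 : ∀ A → msum G A (replicate (length A) 0) ≈ ε
  msum-replicate-0 [] = refl
  msum-replicate-0 (a ∷ A) = trans (identityˡ _) (msum-replicate-0 A)

  x∙y⁻¹≈z∙w⁻¹⇒x∙w≈z∙y : ∀ {x y z w} → x ∙ y ⁻¹ ≈ z ∙ w ⁻¹ → x ∙ w ≈ z ∙ y
  x∙y⁻¹≈z∙w⁻¹⇒x∙w≈z∙y {x} {y} {z} {w} eq = begin
    x ∙ w                ≈⟨ insertᶜ (inverseˡ y) x w ⟩
    (x ∙ y ⁻¹) ∙ (y ∙ w) ≈⟨ ∙-cong eq (comm y w) ⟩
    (z ∙ w ⁻¹) ∙ (w ∙ y) ≈⟨ cancelᶜ (inverseˡ w) z y ⟩
    z ∙ y                ∎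

  n·ε≈ε : ∀ n → n · ε ≈ ε
  n·ε≈ε zero = refl
  n·ε≈ε (suc n) = trans (identityˡ _) (n·ε≈ε n)

  ·-mod : ∀ {m a} n → suc m · a ≈ ε → n · a ≈ (n % suc m) · a
  ·-mod {m} {a} n ma≈ε = begin
    n · a                                    ≡⟨ cong (_· a) (m≡m%n+[m/n]*n n (suc m)) ⟩
    (n % suc m + n / suc m * suc m) · a      ≈⟨ ×-homo-+ a (n % suc m) _ ⟩
    (n % suc m) · a ∙ (n / suc m * suc m) · a ≈⟨ ∙-congˡ (×-assocˡ a (n / suc m) (suc m)) ⟨
    (n % suc m) · a ∙ (n / suc m) · (suc m · a) ≈⟨ ∙-congˡ (×-congʳ (n / suc m) ma≈ε) ⟩
    (n % suc m) · a ∙ (n / suc m) · ε        ≈⟨ ∙-congˡ (n·ε≈ε (n / suc m)) ⟩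
    (n % suc m) · a ∙ ε                      ≈⟨ identityʳ _ ⟩
    (n % suc m) · a                          ∎

  msum-[] : (m : Vec ℕ 0) → msum G [] m ≈ ε
  msum-[] [] = refl

  indicator : ∀ {x} A → x ∈ A → Vec ℕ (length A)
  indicator (a ∷ A) (here _) = 1 ∷ replicate (length A) 0
  indicator (a ∷ A) (there x∈A) = 0 ∷ indicator A x∈A

  sum-indicator : ∀ {x} A (x∈A : x ∈ A) → sum (indicator A x∈A) ≡ 1
  sum-indicator (a ∷ A) (here _) = cong suc (sum-replicate-0 (length A))
  sum-indicator (a ∷ A) (there x∈A) = sum-indicator A x∈A

  msum-indicator : ∀ {x} A (x∈A : x ∈ A) → msum G A (indicator A x∈A) ≈ x
  msum-indicator (a ∷ A) (here x≈a) =
    trans (∙-cong (identityʳ a) (msum-replicate-0 A)) (trans (identityʳ a) (sym x≈a))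
  msum-indicator (a ∷ A) (there x∈A) = trans (identityˡ _) (msum-indicator A x∈A)

  sum≤1-msum-∈ : ∀ {x} A (m : Vec ℕ (length A)) → sum m ≤ 1 → msum G A m ≈ x → ¬ x ≈ ε → x ∈ A
  sum≤1-msum-∈ [] [] _ m≈x x≉ε = ⊥-elim (x≉ε (sym m≈x))
  sum≤1-msum-∈ (a ∷ A) (zero ∷ m) m≤1 m≈x x≉ε =
    there (sum≤1-msum-∈ A m m≤1 (trans (sym (identityˡ _)) m≈x) x≉ε)
  sum≤1-msum-∈ (a ∷ A) (suc zero ∷ m) (s≤s m≤0) m≈x _ = here (begin
    _                        ≈⟨ m≈x ⟨
    1 · a ∙ msum G A m       ≈⟨ ∙-cong (identityʳ a) (reflexive (cong (msum G A) (sum≡0⇒replicate-0 m (n≤0⇒n≡0 m≤0)))) ⟩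
    a ∙ msum G A (replicate _ 0) ≈⟨ ∙-congˡ (msum-replicate-0 A) ⟩
    a ∙ ε                    ≈⟨ identityʳ a ⟩
    a                        ∎)
  sum≤1-msum-∈ (a ∷ A) (suc (suc _) ∷ m) (s≤s ()) _ _

  module PerfectBasisProperties {s : ℕ} {A : List Carrier} (basis : PerfectBasis G s A) where

    rep : Carrier → Vec ℕ (length A)
    rep g = proj₁ (basis g)

    sum-rep-≤ : ∀ g → sum (rep g) ≤ s
    sum-rep-≤ g = ≤-trans (≤-reflexive (≡.sym (total≡sum (rep g)))) (proj₁ (proj₁ (proj₂ (basis g))))

    msum-rep : ∀ g → msum G A (rep g) ≈ g
    msum-rep g = proj₂ (proj₁ (proj₂ (basis g)))

    msum-injective : ∀ {u v} → sum u ≤ s → sum v ≤ s → msum G A u ≈ msum G A v → u ≡ v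
    msum-injective {u} {v} u≤s v≤s u≈v = ≡.trans (represents u u≤s u≈v) (≡.sym (represents v v≤s refl))
      where
      represents : ∀ m → sum m ≤ s → msum G A m ≈ msum G A v → m ≡ rep (msum G A v)
      represents m m≤s = proj₂ (proj₂ (basis (msum G A v))) m (≤-trans (≤-reflexive (total≡sum m)) m≤s)

    rep-cong : ∀ {x y} → x ≈ y → rep x ≡ rep y
    rep-cong {x} {y} x≈y =
      msum-injective (sum-rep-≤ x) (sum-rep-≤ y) (trans (msum-rep x) (trans x≈y (sym (msum-rep y))))

    rep-injective : ∀ {x y} → rep x ≡ rep y → x ≈ y
    rep-injective {x} {y} eq = trans (sym (msum-rep x)) (trans (reflexive (cong (msum G A) eq)) (msum-rep y))

    _≈?_ : Decidable _≈_
    x ≈? y = map′ rep-injective rep-cong (≡-dec Data.Nat._≟_ (rep x) (rep y))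

    msum-cross : ∀ {x y z w} → sum (x ⊕ w) ≤ s → sum (z ⊕ y) ≤ s →
                 msum G A x ∙ msum G A y ⁻¹ ≈ msum G A z ∙ msum G A w ⁻¹ → x ⊕ w ≡ z ⊕ y
    msum-cross {x} {y} {z} {w} x⊕w≤s z⊕y≤s eq = msum-injective x⊕w≤s z⊕y≤s (begin
      msum G A (x ⊕ w)        ≈⟨ msum-⊕ A x w ⟩
      msum G A x ∙ msum G A w ≈⟨ x∙y⁻¹≈z∙w⁻¹⇒x∙w≈z∙y eq ⟩
      msum G A z ∙ msum G A y ≈⟨ msum-⊕ A z y ⟨
      msum G A (z ⊕ y)        ∎)

    decSetoid : DecSetoid 0ℓ 0ℓ
    decSetoid = record { isDecEquivalence = record { isEquivalence = isEquivalence ; _≟_ = _≈?_ } }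

    ≉ε⇒∈ : s ≤ 1 → ∀ {x} → ¬ x ≈ ε → x ∈ A
    ≉ε⇒∈ s≤1 {x} = sum≤1-msum-∈ A (rep x) (≤-trans (sum-rep-≤ x) s≤1) (msum-rep x)

    ∈⇒≉ε : 1 ≤ s → ∀ {x} → x ∈ A → ¬ x ≈ ε
    ∈⇒≉ε 1≤s {x} x∈A x≈ε = 1+n≢0 (≡.trans (≡.sym (sum-indicator A x∈A))
                                     (≡.trans (cong sum indicator≡0) (sum-replicate-0 (length A))))
      where
      indicator≡0 : indicator A x∈A ≡ replicate (length A) 0
      indicator≡0 = msum-injective (≤-trans (≤-reflexive (sum-indicator A x∈A)) 1≤s)
        (≤-trans (≤-reflexive (sum-replicate-0 (length A))) z≤n)
        (trans (msum-indicator A x∈A) (trans x≈ε (sym (msum-replicate-0 A))))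

  perfectBasis-[]⇒trivial : ∀ {s} → PerfectBasis G s [] → ∀ x → x ≈ ε
  perfectBasis-[]⇒trivial basis x = trans (sym (msum-rep x)) (msum-[] (rep x))
    where open PerfectBasisProperties {A = []} basis

  module SingletonBasis {s : ℕ} {a : Carrier} (basis : PerfectBasis G s (a ∷ [])) where
    open PerfectBasisProperties basis

    log : Carrier → ℕ
    log g = head (rep g)

    log-≤ : ∀ g → log g ≤ s
    log-≤ g with rep g | sum-rep-≤ g
    ... | j ∷ [] | j+0≤s = ≤-trans (≤-reflexive (≡.sym (+-identityʳ j))) j+0≤s

    log-· : ∀ g → log g · a ≈ g
    log-· g with rep g | msum-rep g
    ... | j ∷ [] | ja∙ε≈g = trans (sym (identityʳ _)) ja∙ε≈g

    ·-injective : ∀ {i j} → i ≤ s → j ≤ s → i · a ≈ j · a → i ≡ j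
    ·-injective {i} {j} i≤s j≤s ia≈ja = cong head (msum-injective {i ∷ []} {j ∷ []}
      (≤-trans (≤-reflexive (+-identityʳ i)) i≤s) (≤-trans (≤-reflexive (+-identityʳ j)) j≤s)
      (∙-congʳ ia≈ja))

    order : suc s · a ≈ ε
    order with log (suc s · a) | log-≤ (suc s · a) | log-· (suc s · a)
    ... | zero  | _   | ε≈sa = sym ε≈sa
    ... | suc k | k<s | ka≈sa = ⊥-elim (1+n≰n (≡.subst (λ k → suc k ≤ s) k≡s k<s))
      where
      k≡s : k ≡ s
      k≡s = ·-injective (≤-trans (n≤1+n k) k<s) ≤-refl (∙-cancelˡ a _ _ ka≈sa)

    power : Fin (suc s) → Carrier
    power i = toℕ i · a

    power-homo : ∀ i j → power (i +ℤ[ s ] j) ≈ power i ∙ power j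
    power-homo i j = begin
      toℕ (n mod suc s) · a               ≡⟨ cong (_· a) (toℕ-fromℕ< (m%n<n n (suc s))) ⟩
      (n % suc s) · a                       ≈⟨ ·-mod n order ⟨
      n · a                                 ≈⟨ ×-homo-+ a (toℕ i) (toℕ j) ⟩
      power i ∙ power j                     ∎
      where n = toℕ i + toℕ j

    power-injective : ∀ i j → power i ≈ power j → i ≡ j
    power-injective i j eq = toℕ-injective (·-injective (≤-pred (toℕ<n i)) (≤-pred (toℕ<n j)) eq)

    power-surjective : ∀ x → ∃ λ i → power i ≈ x
    power-surjective x = fromℕ< (s≤s (log-≤ x)) ,
      trans (reflexive (cong (_· a) (toℕ-fromℕ< (s≤s (log-≤ x))))) (log-· x)

    isoToZ : IsoToZ G s
    isoToZ = power , power-homo , power-injective , power-surjective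

  module TwoElementBasis {s : ℕ} {a₀ a₁ : Carrier} {as : List Carrier} (2≤s : 2 ≤ s)
                         (basis : PerfectBasis G s (a₀ ∷ a₁ ∷ as)) where
    open PerfectBasisProperties basis

    Σ⟨_⟩ : Vec ℕ (length (a₀ ∷ a₁ ∷ as)) → Carrier
    Σ⟨_⟩ = msum G (a₀ ∷ a₁ ∷ as)

    1≤s : 1 ≤ s
    1≤s = ≤-trans (n≤1+n 1) 2≤s

    firstMinusRest : Carrier → Carrier
    firstMinusRest g = Σ⟨ simpleFirst (rep g) ⟩ ∙ Σ⟨ dropFirst (rep g) ⟩ ⁻¹

    simpleFirst⊕dropFirst-≤ : ∀ x y → sum (simpleFirst (rep x) ⊕ dropFirst (rep y)) ≤ s
    simpleFirst⊕dropFirst-≤ x y =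
      sum-⊕-dropFirst-≤ (simpleFirst (rep x)) (rep y) 1≤s (sum-simpleFirst-≤1 (rep x)) (sum-rep-≤ y)

    firstMinusRest-injective : ∀ {x y} → firstMinusRest x ≈ firstMinusRest y → x ≈ y
    firstMinusRest-injective {x} {y} eq = rep-injective (simpleFirst-dropFirst-injective (rep x) (rep y)
      (msum-cross (simpleFirst⊕dropFirst-≤ x y) (simpleFirst⊕dropFirst-≤ y x) eq))

    firstMinusRest-misses : ∀ g → ¬ firstMinusRest g ≈ Σ⟨ e₁ (length as) ⟩ ∙ Σ⟨ e₀ (length as) ⟩ ⁻¹
    firstMinusRest-misses g eq = simpleFirst⊕e₀≢e₁⊕dropFirst (rep g) (msum-cross bound₀ bound₁ eq)
      where
      bound₀ : sum (simpleFirst (rep g) ⊕ e₀ (length as)) ≤ s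
      bound₀ = ≤-trans (sum-⊕-≤ (simpleFirst (rep g)) (e₀ _)
                          (sum-simpleFirst-≤1 (rep g)) (≤-reflexive (sum-e₀ (length as)))) 2≤s
      bound₁ : sum (e₁ (length as) ⊕ dropFirst (rep g)) ≤ s
      bound₁ = sum-⊕-dropFirst-≤ (e₁ _) (rep g) 1≤s (≤-reflexive (sum-e₁ (length as))) (sum-rep-≤ g)

    ¬finite : ¬ IsFinite G
    ¬finite (xs , complete) = injective⇒¬¬surjective decSetoid xs complete
      firstMinusRest firstMinusRest-injective _ firstMinusRest-misses

theorem1 : (G : AbelianGroup 0ℓ 0ℓ) →
    let open AbelianGroup G in
    IsFinite G →
    (∃ λ x → ¬ (x ≈ ε)) →
    (s : ℕ) → 1 Data.Nat.≤ s →
    (A : List Carrier) → Distinct G A →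
    PerfectBasis G s A →
    (s ≡ 1 × (∀ x → (_∈ₛ_ G x A → ¬ (x ≈ ε)) × (¬ (x ≈ ε) → _∈ₛ_ G x A)))
    ⊎ (IsoToZ G s × length A ≡ 1)
theorem1 G _ _ 1 1≤s A _ basis = inj₁ (≡.refl , λ x → ∈⇒≉ε 1≤s , ≉ε⇒∈ ≤-refl)
  where open PerfectBasisProperties G {A = A} basis
theorem1 G _ (x , x≉ε) (suc (suc _)) _ [] _ basis = ⊥-elim (x≉ε (perfectBasis-[]⇒trivial G basis x))
theorem1 G _ _ (suc (suc _)) _ (_ ∷ []) _ basis = inj₂ (SingletonBasis.isoToZ G basis , ≡.refl)
theorem1 G finite _ (suc (suc _)) _ (_ ∷ _ ∷ _) _ basis =
  ⊥-elim (TwoElementBasis.¬finite G (s≤s (s≤s z≤n)) basis finite)
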